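{- Let $n,k,d,\ell,\Delta$ be integers with $n\ge3$, $k\ge1$, $\Delta\ge d+\ell\ge0$ and $0\le\ell\le\Delta$. Let the sums below range over all integers $p$ with $1\le p\le\lfloor(n-1)/k\rfloor$ and, when $d+\ell\ge1$, additionally $p\le\lfloor\Delta/(d+\ell)\rfloor$. For such $p$ put $\Delta_p=\Delta-p(d+\ell)$ and $A_p=m(n-pk,\Delta_p,k_=,d_=,\min\{\Delta_p,\ell-1\}_\le)$, $B_p=m(n-pk,\Delta_p,k_=,\min\{\Delta_p,d-1\}_\le,{\Delta_p}_\le)$, $C_p=m(n-pk,\Delta_p,\min\{n-pk-1,k-1\}_\le,{\Delta_p}_\le,{\Delta_p}_\le)$. Then (i) if $d=0$ and $\ell=0$: $m(n,\Delta,k_=,d_=,\ell_=)=\sum_p f(k,d;p)\,C_p$; (ii) if $d\ge1$ and $\ell=0$: $m(n,\Delta,k_=,d_=,\ell_=)=\sum_p f(k,d;p)\,(B_p+C_p)$; (iii) if $d=0$ and $\ell\ge1$: $m(n,\Delta,k_=,d_=,\ell_=)=\sum_p f(k,d;p)\,(A_p+C_p)$; (iv) if $d\ge1$ and $\ell\ge1$: $m(n,\Delta,k_=,d_=,\ell_=)=\sum_p f(k,d;p)\,(A_p+B_p+C_p)$.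
   Context: A tree-like multigraph is a finite tree $T$ (no self-loops) together with ${\rm e}:E(T)\to\mathbb{Z}_{\ge0}$, ${\rm e}(uv)$ being the number of additional (multiple) edges between $u$ and $v$; its number of multiple edges is $\sum_{uv\in E(T)}{\rm e}(uv)$. A rooted tree-like multigraph has a designated root; isomorphism of rooted ones is a bijection preserving adjacency, root and multiplicities. For rooted $M$ with root $r_M$ and a vertex $v$, $M_v$ is the descendant subgraph rooted at $v$ (induced by $v$ and its descendants), ${\rm v}(M_v)$ its number of vertices, ${\rm e}(M_v)$ its number of multiple edges; $N(r_M)$ is the set of children of the root. Define ${\rm Max}_{\rm v}(M)=\max(\{{\rm v}(M_v):v\in N(r_M)\}\cup\{0\})$, ${\rm Max}_{\rm m}(M)=\max(\{{\rm e}(M_v):v\in N(r_M),{\rm v}(M_v)={\rm Max}_{\rm v}(M)\}\cup\{0\})$, ${\rm Max}_{\rm l}(M)=\max(\{{\rm e}(r_Mv):v\in N(r_M),{\rm v}(M_v)={\rm Max}_{\rm v}(M),{\rm e}(M_v)={\rm Max}_{\rm m}(M)\}\cup\{0\})$. $\mathcal{M}(n,\Delta)$ is the set of isomorphism classes of rooted tree-like multigraphs with $n$ vertices and $\Delta$ multiple edges. For integers $k,d,\ell$: $\mathcal{M}(n,\Delta,k_\le,d_\le,\ell_\le)$ consists of $M\in\mathcal{M}(n,\Delta)$ with ${\rm Max}_{\rm v}\le k$, ${\rm Max}_{\rm m}\le d$, ${\rm Max}_{\rm l}\le\ell$; $\mathcal{M}(n,\Delta,k_=,d_\le,\ell_\le)$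 additionally requires ${\rm Max}_{\rm v}=k$; $\mathcal{M}(n,\Delta,k_=,d_=,\ell_\le)$ additionally ${\rm Max}_{\rm m}=d$; $\mathcal{M}(n,\Delta,k_=,d_=,\ell_=)$ additionally ${\rm Max}_{\rm l}=\ell$ (negative bounds give empty families). $m(\cdot)$ denotes the cardinality of the corresponding $\mathcal{M}(\cdot)$. For integers $x\ge0$, $f(k,d;x)=\binom{m(k,d,{k-1}_\le,d_\le,d_\le)+x-1}{x}$, the number of multisets of size $x$ from $\mathcal{M}(k,d,{k-1}_\le,d_\le,d_\le)$, where $\binom{a}{x}=a(a-1)\cdots(a-x+1)/x!$. -}

module Defs where

open import Data.Nat using (ℕ; zero; suc; _+_; _*_; _∸_; _≤_; _⊔_; _⊓_; _≡ᵇ_; _≤ᵇ_)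
open import Data.Nat.Combinatorics using (_C_)
open import Data.Bool using (Bool; true; false; if_then_else_; _∧_)
open import Data.List using (List; []; _∷_; _++_)
open import Data.Product using (Σ; _×_; _,_)
open import Data.Vec using (Vec; lookup)
open import Data.Fin using (Fin)
open import Relation.Binary.PropositionalEquality using (_≡_)

-- Rooted tree-like multigraphs.
-- A vertex is given by the list of its children; each child comes with
-- e(uv), the number of additional (multiple) edges between the vertex
-- and that child.

data RTree : Set where
  node : List (ℕ × RTree) → RTree

mutual
  vs : RTree → ℕ
  vs (node cs) = suc (vsL cs)

  vsL : List (ℕ × RTree) → ℕ
  vsL [] = 0
  vsL ((_ , t) ∷ cs) = vs t + vsL cs

mutual
  es : RTree → ℕ
  es (node cs) = esL cs

  esL : List (ℕ × RTree) → ℕ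
  esL [] = 0
  esL ((x , t) ∷ cs) = x + es t + esL cs

-- Max_v, Max_m, Max_l (all maxima over sets of naturals, with 0 adjoined)
maxVL : List (ℕ × RTree) → ℕ
maxVL [] = 0
maxVL ((_ , t) ∷ cs) = vs t ⊔ maxVL cs

maxV : RTree → ℕ
maxV (node cs) = maxVL cs

maxML : ℕ → List (ℕ × RTree) → ℕ
maxML kv [] = 0
maxML kv ((_ , t) ∷ cs) = (if vs t ≡ᵇ kv then es t else 0) ⊔ maxML kv cs

maxM : RTree → ℕ
maxM (node cs) = maxML (maxVL cs) cs

maxLL : ℕ → ℕ → List (ℕ × RTree) → ℕ
maxLL kv km [] = 0
maxLL kv km ((x , t) ∷ cs) =
  (if (vs t ≡ᵇ kv) ∧ (es t ≡ᵇ km) then x else 0) ⊔ maxLL kv km cs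

maxL : RTree → ℕ
maxL (node cs) = maxLL (maxVL cs) (maxML (maxVL cs) cs) cs

-- Isomorphism of rooted tree-like multigraphs: the children of the two
-- roots are matched bijectively, matched children having the same
-- edge multiplicity to the root and isomorphic descendant subgraphs.

mutual
  data _≅_ : RTree → RTree → Set where
    node : ∀ {xs ys} → xs ≋ ys → node xs ≅ node ys

  data _≋_ : List (ℕ × RTree) → List (ℕ × RTree) → Set where
    []   : [] ≋ []
    cons : ∀ {x t t' xs ys zs} → t ≅ t' → xs ≋ (ys ++ zs) →
           ((x , t) ∷ xs) ≋ (ys ++ (x , t') ∷ zs)

data Bd : Set where
  le eq : Bd

Rel : Bd → ℕ → ℕ → Set
Rel le a b = a ≤ b
Rel eq a b = a ≡ b

Fam : ℕ → ℕ → Bd → ℕ → Bd → ℕ → Bd → ℕ → RTree → Set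
Fam n Δ bk k bd d bl l M =
  vs M ≡ n × es M ≡ Δ × Rel bk (maxV M) k × Rel bd (maxM M) d × Rel bl (maxL M) l

-- "the isomorphism classes of trees satisfying P are exactly c many":
-- a list of c representatives, pairwise non-isomorphic, covering P.
HasCount : (RTree → Set) → ℕ → Set
HasCount P c = Σ (Vec RTree c) λ ts →
  ((i : Fin c) → P (lookup ts i)) ×
  ((i j : Fin c) → lookup ts i ≅ lookup ts j → i ≡ j) ×
  ((M : RTree) → P M → Σ (Fin c) λ i → M ≅ lookup ts i)

Counter : Set
Counter = ℕ → ℕ → Bd → ℕ → Bd → ℕ → Bd → ℕ → ℕ

IsCounter : Counter → Set
IsCounter m = ∀ n Δ bk k bd d bl l →
  HasCount (Fam n Δ bk k bd d bl l) (m n Δ bk k bd d bl l)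

-- f(k,d;x) = binom(m(k,d,(k-1)_≤,d_≤,d_≤) + x - 1, x)
-- (natural-number truncation agrees with the generalized binomial:
--  when the count is 0 and x ≥ 1 both give 0; for x = 0 both give 1)
fK : Counter → ℕ → ℕ → ℕ → ℕ
fK m k d x = (m k d le (k ∸ 1) le d le d + x ∸ 1) C x

sumP : ℕ → (ℕ → Bool) → (ℕ → ℕ) → ℕ
sumP zero    cond F = 0
sumP (suc N) cond F = sumP N cond F + (if cond (suc N) then F (suc N) else 0)

-- admissible p: p ≤ ⌊(n-1)/k⌋ (i.e. p*k ≤ n-1) and
-- p ≤ ⌊Δ/(d+ℓ)⌋ when d+ℓ ≥ 1 (i.e. p*(d+ℓ) ≤ Δ; vacuous if d+ℓ = 0)
admissible : ℕ → ℕ → ℕ → ℕ → ℕ → ℕ → Bool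
admissible n k d l Δ p = (p * k ≤ᵇ n ∸ 1) ∧ (p * (d + l) ≤ᵇ Δ)

Δp : ℕ → ℕ → ℕ → ℕ → ℕ
Δp d l Δ p = Δ ∸ p * (d + l)

Ap Bp Cp : Counter → ℕ → ℕ → ℕ → ℕ → ℕ → ℕ → ℕ
Ap m n k d l Δ p = m (n ∸ p * k) (Δp d l Δ p) eq k eq d le (Δp d l Δ p ⊓ (l ∸ 1))
Bp m n k d l Δ p = m (n ∸ p * k) (Δp d l Δ p) eq k le (Δp d l Δ p ⊓ (d ∸ 1)) le (Δp d l Δ p)
Cp m n k d l Δ p = m (n ∸ p * k) (Δp d l Δ p) le ((n ∸ p * k ∸ 1) ⊓ (k ∸ 1)) le (Δp d l Δ p) le (Δp d l Δ p)

module Submission where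

-- A child c of the root, i.e. a pair (e(r v), M_v), has the key (v(M_v), e(M_v), e(r v)), and
-- (Max_v, Max_m, Max_l) of a tree is exactly the lexicographic maximum of the keys of the
-- children of its root (or (0,0,0) for a single vertex). So a tree M lies in
-- M(n, Δ, k_=, d_=, ℓ_=) iff its children split into p ≥ 1 "top" children with key (k, d, ℓ),
-- which contribute pk vertices and p(d+ℓ) multiple edges, and the remaining children, all of
-- key strictly below (k, d, ℓ). The top children form an arbitrary multiset of size p of trees
-- of M(k, d, (k-1)_≤, d_≤, d_≤), counted by f(k,d;p); the remaining children hang from a root
-- of a tree with n - pk vertices, Δ_p multiple edges and root key below (k, d, ℓ), and the
-- three ways of being lexicographically below (k, d, ℓ) are the families counted by A_p, B_p
-- and C_p.

open import Defs
open import Data.Nat using (ℕ; zero; suc; _+_; _*_; _∸_; _≤_; _<_; _⊔_; _⊓_; z≤n; s≤s; _≟_)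
open import Data.Nat.Properties
  using (+-assoc; +-comm; +-suc; +-identityʳ; *-identityʳ; +-commutativeSemigroup;
         ≤-refl; ≤-trans; ≤-antisym; <-trans; <-irrefl; <-asym; 1+n≰n; n≮0; n<1+n; n≤0⇒n≡0;
         suc-injective; m≤n⇒m<n∨m≡n; m≤n⇒m≤1+n; m≤m+n; m≤n+m; *-monoʳ-≤; m∸n≤m;
         m+n∸m≡n; m+[n∸m]≡n; m≤m⊔n; m≤n⊔m; ⊔-sel; ⊔-lub; ⊔-identityʳ; ⊓-glb; m≤n⊓o⇒m≤o;
         ≤ᵇ⇒≤; ≤⇒≤ᵇ)
open import Data.Nat.Combinatorics using (_C_; nCk+nC[k+1]≡[n+1]C[k+1]; k>n⇒nCk≡0)
open import Algebra.Properties.CommutativeSemigroup +-commutativeSemigroup using (x∙yz≈y∙xz)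
open import Data.Bool using (Bool; true; false; if_then_else_; T)
open import Data.Bool.Properties using (T-∧)
open import Data.Unit using (⊤; tt)
open import Data.Sum using (_⊎_; inj₁; inj₂; [_,_]′)
open import Data.Product using (_×_; Σ; ∃; ∃₂; _,_; proj₁; proj₂; curry)
import Data.Product as Product
open import Data.Product.Properties using (≡-dec; ,-injective)
open import Data.Product.Relation.Binary.Lex.Strict using (×-Lex; ×-transitive; ×-asymmetric)
open import Data.Fin using (Fin; zero; suc; splitAt; _↑ˡ_; _↑ʳ_; remQuot; combine)
import Data.Fin.Properties as Fin
open import Data.Fin.Properties
  using (injective⇒≤; splitAt-↑ˡ; splitAt-↑ʳ; splitAt⁻¹-↑ˡ; splitAt⁻¹-↑ʳ;
         remQuot-combine; combine-remQuot)
open import Data.Vec using (lookup)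
open import Data.List using (List; []; _∷_; _++_; length; foldr; filter)
open import Data.List.Properties
  using (++-assoc; ∷-injective; ++-identityʳ; filter-++; filter-all; filter-none; filter-some)
open import Data.List.Membership.Propositional using (find; lose)
open import Data.List.Relation.Unary.All as All using (All; []; _∷_)
open import Data.List.Relation.Unary.All.Properties
  using (++⁺; ++⁻; all-filter; filter⁺; filter⁻)
open import Data.List.Relation.Unary.Any as Any using (Any; here; there)
open import Data.List.Relation.Unary.Any.Properties using () renaming (filter⁻ to Any-filter⁻)
open import Function using (_∘_; _⇔_; mk⇔; Equivalence)
open import Function.Definitions using (Injective)
open import Relation.Nullary using (¬_; ¬?; yes; no; does; contradiction; _×-dec_)
open import Relation.Unary using (Decidable; _⊆_; _∪_)
open import Relation.Unary.Properties using (U?)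
open import Relation.Binary.PropositionalEquality
  using (_≡_; _≢_; refl; sym; trans; cong; cong₂; subst; subst₂; isEquivalence; resp₂;
         module ≡-Reasoning)

Child : Set
Child = ℕ × RTree

Forest : Set
Forest = List Child

-- Isomorphism is an equivalence relation

insert-remove-comm : ∀ (w₁ w₂ u₁ u₂ : Forest) a b → w₁ ++ w₂ ≡ u₁ ++ a ∷ u₂ →
  ∃₂ λ z₁ z₂ → ∃₂ λ v₁ v₂ →
    w₁ ++ b ∷ w₂ ≡ z₁ ++ a ∷ z₂ × z₁ ++ z₂ ≡ v₁ ++ b ∷ v₂ × v₁ ++ v₂ ≡ u₁ ++ u₂
insert-remove-comm [] w₂ u₁ u₂ a b w≡u =
  b ∷ u₁ , u₂ , [] , u₁ ++ u₂ , cong (b ∷_) w≡u , refl , refl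
insert-remove-comm (c ∷ w₁) w₂ [] u₂ a b w≡u with ∷-injective w≡u
... | refl , w≡u′ = [] , w₁ ++ b ∷ w₂ , w₁ , w₂ , refl , refl , w≡u′
insert-remove-comm (c ∷ w₁) w₂ (_ ∷ u₁) u₂ a b w≡u with ∷-injective w≡u
... | refl , w≡u′ with insert-remove-comm w₁ w₂ u₁ u₂ a b w≡u′
... | z₁ , z₂ , v₁ , v₂ , p , q , r =
  c ∷ z₁ , z₂ , c ∷ v₁ , v₂ , cong (c ∷_) p , cong (c ∷_) q , cong (c ∷_) r

mutual
  ≅-refl : ∀ t → t ≅ t
  ≅-refl (node cs) = node (≋-refl cs)

  ≋-refl : ∀ cs → cs ≋ cs
  ≋-refl [] = []
  ≋-refl ((x , t) ∷ cs) = cons {ys = []} (≅-refl t) (≋-refl cs)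

≋-remove : ∀ (ys₁ ys₂ : Forest) x t zs → (ys₁ ++ (x , t) ∷ ys₂) ≋ zs →
  ∃₂ λ z₁ z₂ → Σ RTree λ t′ →
    zs ≡ z₁ ++ (x , t′) ∷ z₂ × t ≅ t′ × (ys₁ ++ ys₂) ≋ (z₁ ++ z₂)
≋-remove [] ys₂ x t _ (cons {t' = t′} {ys = w₁} {zs = w₂} e p) =
  w₁ , w₂ , t′ , refl , e , p
≋-remove ((y , s) ∷ ys₁) ys₂ x t _ (cons {t' = s′} {ys = w₁} {zs = w₂} e p)
  with ≋-remove ys₁ ys₂ x t (w₁ ++ w₂) p
... | u₁ , u₂ , t′ , w≡u , e′ , r
  with insert-remove-comm w₁ w₂ u₁ u₂ (x , t′) (y , s′) w≡u
... | z₁ , z₂ , v₁ , v₂ , p₁ , p₂ , p₃ =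
  z₁ , z₂ , t′ , p₁ , e′ , subst (_ ≋_) (sym p₂) (cons e (subst (_ ≋_) (sym p₃) r))

≋-insert : ∀ (ys₁ ys₂ : Forest) x {t t′} zs → t ≅ t′ → (ys₁ ++ ys₂) ≋ zs →
  (ys₁ ++ (x , t) ∷ ys₂) ≋ ((x , t′) ∷ zs)
≋-insert [] ys₂ x zs e p = cons {ys = []} e p
≋-insert ((y , s) ∷ ys₁) ys₂ x {t′ = t′} _ e (cons {ys = r₁} {zs = r₂} e′ p) =
  cons {ys = (x , t′) ∷ r₁} e′ (≋-insert ys₁ ys₂ x (r₁ ++ r₂) e p)

mutual
  ≅-sym : ∀ {s t} → s ≅ t → t ≅ s
  ≅-sym (node p) = node (≋-sym p)

  ≋-sym : ∀ {xs ys} → xs ≋ ys → ys ≋ xs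
  ≋-sym [] = []
  ≋-sym (cons {x = x} {xs = xs} {ys = ys} {zs = zs} e p) =
    ≋-insert ys zs x xs (≅-sym e) (≋-sym p)

mutual
  ≅-trans : ∀ {s t u} → s ≅ t → t ≅ u → s ≅ u
  ≅-trans (node p) (node q) = node (≋-trans p q)

  ≋-trans : ∀ {xs ys zs} → xs ≋ ys → ys ≋ zs → xs ≋ zs
  ≋-trans [] q = q
  ≋-trans (cons {x = x} {t' = t′} {ys = ys} {zs = zs} e p) q with ≋-remove ys zs x t′ _ q
  ... | _ , _ , _ , refl , e′ , r = cons (≅-trans e e′) (≋-trans p r)

≋-++ : ∀ {xs xs′ ys ys′} → xs ≋ xs′ → ys ≋ ys′ → (xs ++ ys) ≋ (xs′ ++ ys′)
≋-++ [] q = q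
≋-++ {ys′ = ys′} (cons {x = x} {t' = t′} {ys = u₁} {zs = u₂} e p) q =
  subst (_ ≋_) (sym (++-assoc u₁ ((x , t′) ∷ u₂) ys′))
    (cons {ys = u₁} e (subst (_ ≋_) (++-assoc u₁ u₂ ys′) (≋-++ p q)))

≋-∷-cancel : ∀ {x t t′ ys zs} → t ≅ t′ → ((x , t) ∷ ys) ≋ ((x , t′) ∷ zs) → ys ≋ zs
≋-∷-cancel {x} {t} {ys = ys} e p with ≋-remove [] ys x t _ p
... | [] , _ , _ , refl , _ , r = r
... | _ ∷ z₁ , z₂ , _ , refl , e′ , r =
  ≋-trans r (cons {ys = z₁} (≅-trans (≅-sym e) e′) (≋-refl (z₁ ++ z₂)))

-- Invariants of isomorphism

vsL-insert : ∀ (ys zs : Forest) x t → vsL (ys ++ (x , t) ∷ zs) ≡ vs t + vsL (ys ++ zs)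
vsL-insert [] zs x t = refl
vsL-insert ((_ , s) ∷ ys) zs x t =
  trans (cong (vs s +_) (vsL-insert ys zs x t)) (x∙yz≈y∙xz (vs s) (vs t) _)

esL-insert : ∀ (ys zs : Forest) x t → esL (ys ++ (x , t) ∷ zs) ≡ x + es t + esL (ys ++ zs)
esL-insert [] zs x t = refl
esL-insert ((y , s) ∷ ys) zs x t =
  trans (cong (y + es s +_) (esL-insert ys zs x t)) (x∙yz≈y∙xz (y + es s) (x + es t) _)

mutual
  vs-resp : ∀ {s t} → s ≅ t → vs s ≡ vs t
  vs-resp (node p) = cong suc (vsL-resp p)

  vsL-resp : ∀ {xs ys} → xs ≋ ys → vsL xs ≡ vsL ys
  vsL-resp [] = refl
  vsL-resp (cons {x = x} {t' = t′} {ys = ys} {zs = zs} e p) =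
    trans (cong₂ _+_ (vs-resp e) (vsL-resp p)) (sym (vsL-insert ys zs x t′))

mutual
  es-resp : ∀ {s t} → s ≅ t → es s ≡ es t
  es-resp (node p) = esL-resp p

  esL-resp : ∀ {xs ys} → xs ≋ ys → esL xs ≡ esL ys
  esL-resp [] = refl
  esL-resp (cons {x = x} {t' = t′} {ys = ys} {zs = zs} e p) =
    trans (cong₂ _+_ (cong (x +_) (es-resp e)) (esL-resp p)) (sym (esL-insert ys zs x t′))

vsL-++ : ∀ xs ys → vsL (xs ++ ys) ≡ vsL xs + vsL ys
vsL-++ [] ys = refl
vsL-++ ((_ , t) ∷ xs) ys = trans (cong (vs t +_) (vsL-++ xs ys)) (sym (+-assoc (vs t) _ _))

esL-++ : ∀ xs ys → esL (xs ++ ys) ≡ esL xs + esL ys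
esL-++ [] ys = refl
esL-++ ((x , t) ∷ xs) ys =
  trans (cong (x + es t +_) (esL-++ xs ys)) (sym (+-assoc (x + es t) _ _))

All-resp-≋ : ∀ {P : Child → Set} → (∀ {x t t′} → t ≅ t′ → P (x , t) → P (x , t′)) →
  ∀ {xs ys} → xs ≋ ys → All P xs → All P ys
All-resp-≋ resp [] [] = []
All-resp-≋ resp (cons {ys = ys} e p) (px ∷ pxs) with ++⁻ ys (All-resp-≋ resp p pxs)
... | pys , pzs = ++⁺ pys (resp e px ∷ pzs)

length-insert : ∀ (ys zs : Forest) c → length (ys ++ c ∷ zs) ≡ suc (length (ys ++ zs))
length-insert [] zs c = refl
length-insert (_ ∷ ys) zs c = cong suc (length-insert ys zs c)

length-resp-≋ : ∀ {xs ys} → xs ≋ ys → length xs ≡ length ys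
length-resp-≋ [] = refl
length-resp-≋ (cons {ys = ys} {zs = zs} _ p) =
  trans (cong suc (length-resp-≋ p)) (sym (length-insert ys zs _))

filter-resp-≋ : ∀ {S : Child → Set} (S? : Decidable S) →
  (∀ {x t t′} → t ≅ t′ → S (x , t) → S (x , t′)) →
  ∀ {xs ys} → xs ≋ ys → filter S? xs ≋ filter S? ys
filter-resp-≋ S? S-resp [] = []
filter-resp-≋ S? S-resp (cons {x = x} {t = t} {t' = t′} {ys = ys} {zs = zs} e p)
  rewrite filter-++ S? ys ((x , t′) ∷ zs) with S? (x , t) | S? (x , t′)
... | yes _ | yes _ = cons e (subst (_ ≋_) (filter-++ S? ys zs) (filter-resp-≋ S? S-resp p))
... | no _  | no _  = subst (_ ≋_) (filter-++ S? ys zs) (filter-resp-≋ S? S-resp p)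
... | yes s | no ¬s′ = contradiction (S-resp e s) ¬s′
... | no ¬s | yes s′ = contradiction (S-resp (≅-sym e) s′) ¬s

-- The root key

module _ {A : Set} {P : A → Set} (P? : Decidable P) (f : A → ℕ) where

  maxBy : List A → ℕ
  maxBy = foldr (λ a m → (if does (P? a) then f a else 0) ⊔ m) 0

  maxBy-upper : ∀ xs → All (λ a → P a → f a ≤ maxBy xs) xs
  maxBy-upper [] = []
  maxBy-upper (a ∷ xs) =
    upper-head ∷ All.map (λ h pa → ≤-trans (h pa) (m≤n⊔m _ _)) (maxBy-upper xs)
    where
    upper-head : P a → f a ≤ maxBy (a ∷ xs)
    upper-head pa with P? a
    ... | yes _ = m≤m⊔n _ _
    ... | no ¬pa = contradiction pa ¬pa

  maxBy-lub : ∀ {v} xs → All (λ a → P a → f a ≤ v) xs → maxBy xs ≤ v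
  maxBy-lub [] [] = z≤n
  maxBy-lub (a ∷ xs) (h ∷ hs) with P? a
  ... | yes pa = ⊔-lub (h pa) (maxBy-lub xs hs)
  ... | no _ = maxBy-lub xs hs

  maxBy-sel : ∀ xs → maxBy xs ≡ 0 ⊎ Any (λ a → P a × f a ≡ maxBy xs) xs
  maxBy-sel [] = inj₁ refl
  maxBy-sel (a ∷ xs) with P? a | maxBy-sel xs
  ... | no _ | inj₁ m≡0 = inj₁ m≡0
  ... | no _ | inj₂ any = inj₂ (there any)
  ... | yes pa | inj₁ m≡0 =
    inj₂ (here (pa , trans (sym (⊔-identityʳ (f a))) (cong (f a ⊔_) (sym m≡0))))
  ... | yes pa | inj₂ any with ⊔-sel (f a) (maxBy xs)
  ...   | inj₁ e = inj₂ (here (pa , sym e))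
  ...   | inj₂ e = inj₂ (there (Any.map (λ (pb , fb) → pb , trans fb (sym e)) any))

  maxBy-attained : ∀ {xs} → Any P xs → Any (λ a → P a × f a ≡ maxBy xs) xs
  maxBy-attained {xs} any with maxBy-sel xs
  ... | inj₂ attained = attained
  ... | inj₁ m≡0 with find any
  ...   | a , a∈xs , pa = lose a∈xs (pa , trans (n≤0⇒n≡0 fa≤0) (sym m≡0))
    where
    fa≤0 : f a ≤ 0
    fa≤0 = subst (f a ≤_) m≡0 (All.lookup (maxBy-upper xs) a∈xs pa)

Key : Set
Key = ℕ × ℕ × ℕ

0ₖ : Key
0ₖ = 0 , 0 , 0

_<ₗ_ : Key → Key → Set
_<ₗ_ = ×-Lex _≡_ _<_ (×-Lex _≡_ _<_ _<_)

_≤ₗ_ : Key → Key → Set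
a ≤ₗ b = a <ₗ b ⊎ a ≡ b

<ₗ-trans : ∀ {a b c} → a <ₗ b → b <ₗ c → a <ₗ c
<ₗ-trans = ×-transitive {_<₂_ = ×-Lex _≡_ _<_ _<_} isEquivalence (resp₂ _<_) <-trans
             (×-transitive {_<₂_ = _<_} isEquivalence (resp₂ _<_) <-trans <-trans)

<ₗ-asym : ∀ {a b} → a <ₗ b → ¬ b <ₗ a
<ₗ-asym = ×-asymmetric {_<₂_ = ×-Lex _≡_ _<_ _<_} sym (resp₂ _<_) <-asym
            (×-asymmetric {_<₂_ = _<_} sym (resp₂ _<_) <-asym <-asym)

≤ₗ-antisym : ∀ {a b} → a ≤ₗ b → b ≤ₗ a → a ≡ b
≤ₗ-antisym (inj₂ a≡b) _ = a≡b
≤ₗ-antisym (inj₁ _) (inj₂ b≡a) = sym b≡a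
≤ₗ-antisym (inj₁ a<b) (inj₁ b<a) = contradiction b<a (<ₗ-asym a<b)

≤ₗ-<ₗ-trans : ∀ {a b c} → a ≤ₗ b → b <ₗ c → a <ₗ c
≤ₗ-<ₗ-trans (inj₁ a<b) b<c = <ₗ-trans a<b b<c
≤ₗ-<ₗ-trans (inj₂ refl) b<c = b<c

≤ₗ-intro : ∀ {a b c a′ b′ c′} →
  a ≤ a′ → (a ≡ a′ → b ≤ b′) → (a ≡ a′ → b ≡ b′ → c ≤ c′) → (a , b , c) ≤ₗ (a′ , b′ , c′)
≤ₗ-intro a≤a′ b≤b′ c≤c′ with m≤n⇒m<n∨m≡n a≤a′
... | inj₁ a<a′ = inj₁ (inj₁ a<a′)
... | inj₂ a≡a′ with m≤n⇒m<n∨m≡n (b≤b′ a≡a′)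
...   | inj₁ b<b′ = inj₁ (inj₂ (a≡a′ , inj₁ b<b′))
...   | inj₂ b≡b′ with m≤n⇒m<n∨m≡n (c≤c′ a≡a′ b≡b′)
...     | inj₁ c<c′ = inj₁ (inj₂ (a≡a′ , inj₂ (b≡b′ , c<c′)))
...     | inj₂ c≡c′ = inj₂ (cong₂ _,_ a≡a′ (cong₂ _,_ b≡b′ c≡c′))

0ₖ≤ₗ : ∀ a → 0ₖ ≤ₗ a
0ₖ≤ₗ _ = ≤ₗ-intro z≤n (λ _ → z≤n) (λ _ _ → z≤n)

vsᶜ esᶜ : Child → ℕ
vsᶜ = vs ∘ proj₂
esᶜ = es ∘ proj₂

key : Child → Key
key c = vsᶜ c , esᶜ c , proj₁ c

rootKey : RTree → Key
rootKey M = maxV M , maxM M , maxL M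

maxBy≡maxVL : ∀ ys → maxBy U? vsᶜ ys ≡ maxVL ys
maxBy≡maxVL [] = refl
maxBy≡maxVL ((_ , t) ∷ ys) = cong (vs t ⊔_) (maxBy≡maxVL ys)

maxBy≡maxML : ∀ v ys → maxBy (λ c → vsᶜ c ≟ v) esᶜ ys ≡ maxML v ys
maxBy≡maxML v [] = refl
maxBy≡maxML v (_ ∷ ys) = cong (_ ⊔_) (maxBy≡maxML v ys)

maxBy≡maxLL : ∀ v m ys → maxBy (λ c → (vsᶜ c ≟ v) ×-dec (esᶜ c ≟ m)) proj₁ ys ≡ maxLL v m ys
maxBy≡maxLL v m [] = refl
maxBy≡maxLL v m (_ ∷ ys) = cong (_ ⊔_) (maxBy≡maxLL v m ys)

key≤ₗrootKey : ∀ ys → All (λ c → key c ≤ₗ rootKey (node ys)) ys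
key≤ₗrootKey ys = All.zipWith bound (vs-upper , All.zip (es-upper , mult-upper))
  where
  V = maxVL ys
  M = maxML V ys
  vs-upper : All (λ c → ⊤ → vsᶜ c ≤ V) ys
  vs-upper = subst (λ u → All (λ c → ⊤ → vsᶜ c ≤ u) ys) (maxBy≡maxVL ys) (maxBy-upper U? vsᶜ ys)
  es-upper : All (λ c → vsᶜ c ≡ V → esᶜ c ≤ M) ys
  es-upper = subst (λ u → All (λ c → vsᶜ c ≡ V → esᶜ c ≤ u) ys) (maxBy≡maxML V ys)
               (maxBy-upper (λ c → vsᶜ c ≟ V) esᶜ ys)
  mult-upper : All (λ c → vsᶜ c ≡ V × esᶜ c ≡ M → proj₁ c ≤ maxLL V M ys) ys
  mult-upper = subst (λ u → All (λ c → vsᶜ c ≡ V × esᶜ c ≡ M → proj₁ c ≤ u) ys)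
                 (maxBy≡maxLL V M ys) (maxBy-upper (λ c → (vsᶜ c ≟ V) ×-dec (esᶜ c ≟ M)) proj₁ ys)
  bound : ∀ {c} → _ → key c ≤ₗ rootKey (node ys)
  bound (v≤ , m≤ , l≤) = ≤ₗ-intro (v≤ tt) m≤ (curry l≤)

rootKey-sel : ∀ ys → rootKey (node ys) ≡ 0ₖ ⊎ Any (λ c → key c ≡ rootKey (node ys)) ys
rootKey-sel [] = inj₁ refl
rootKey-sel ys@(_ ∷ _) =
  inj₂ (Any.map (λ ((v≡ , m≡) , l≡) → cong₂ _,_ v≡ (cong₂ _,_ m≡ l≡)) mult-attained)
  where
  V = maxVL ys
  M = maxML V ys
  vs-attained : Any (λ c → ⊤ × vsᶜ c ≡ V) ys
  vs-attained = subst (λ u → Any (λ c → ⊤ × vsᶜ c ≡ u) ys) (maxBy≡maxVL ys)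
                  (maxBy-attained U? vsᶜ (here tt))
  es-attained : Any (λ c → vsᶜ c ≡ V × esᶜ c ≡ M) ys
  es-attained = subst (λ u → Any (λ c → vsᶜ c ≡ V × esᶜ c ≡ u) ys) (maxBy≡maxML V ys)
                  (maxBy-attained (λ c → vsᶜ c ≟ V) esᶜ (Any.map proj₂ vs-attained))
  mult-attained : Any (λ c → (vsᶜ c ≡ V × esᶜ c ≡ M) × proj₁ c ≡ maxLL V M ys) ys
  mult-attained = subst (λ u → Any (λ c → (vsᶜ c ≡ V × esᶜ c ≡ M) × proj₁ c ≡ u) ys)
                    (maxBy≡maxLL V M ys)
                    (maxBy-attained (λ c → (vsᶜ c ≟ V) ×-dec (esᶜ c ≟ M)) proj₁ es-attained)

All-key⇒rootKey : ∀ {R : Key → Set} ys → R 0ₖ → All (R ∘ key) ys → R (rootKey (node ys))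
All-key⇒rootKey {R} ys r₀ rs with rootKey-sel ys
... | inj₁ root≡0 = subst R (sym root≡0) r₀
... | inj₂ attained = All.lookupWith (λ r key≡ → subst R key≡ r) rs attained

key-resp : ∀ {x t t′} → t ≅ t′ → key (x , t) ≡ key (x , t′)
key-resp e = cong₂ _,_ (vs-resp e) (cong₂ _,_ (es-resp e) refl)

rootKey-resp : ∀ {xs ys} → xs ≋ ys → rootKey (node xs) ≡ rootKey (node ys)
rootKey-resp xs≋ys = ≤ₗ-antisym (bounded-by xs≋ys) (bounded-by (≋-sym xs≋ys))
  where
  bounded-by : ∀ {xs ys} → xs ≋ ys → rootKey (node xs) ≤ₗ rootKey (node ys)
  bounded-by {xs} {ys} xs≋ys = All-key⇒rootKey {_≤ₗ rootKey (node ys)} xs (0ₖ≤ₗ _)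
    (All-resp-≋ (λ e → subst (_≤ₗ rootKey (node ys)) (key-resp e)) (≋-sym xs≋ys) (key≤ₗrootKey ys))

rootKey≡⇔ : ∀ {K} → K ≢ 0ₖ → ∀ ys →
  rootKey (node ys) ≡ K ⇔ (All (λ c → key c ≤ₗ K) ys × Any (λ c → key c ≡ K) ys)
rootKey≡⇔ {K} K≢0 ys = mk⇔ to from
  where
  to : rootKey (node ys) ≡ K → All (λ c → key c ≤ₗ K) ys × Any (λ c → key c ≡ K) ys
  to refl with rootKey-sel ys
  ... | inj₁ root≡0 = contradiction root≡0 K≢0
  ... | inj₂ attained = key≤ₗrootKey ys , attained
  from : All (λ c → key c ≤ₗ K) ys × Any (λ c → key c ≡ K) ys → rootKey (node ys) ≡ K
  from (below , attained) = ≤ₗ-antisym (All-key⇒rootKey {_≤ₗ K} ys (0ₖ≤ₗ K) below)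
    (All.lookupWith {R = λ _ → K ≤ₗ rootKey (node ys)} (λ { c≤root refl → c≤root })
      (key≤ₗrootKey ys) attained)

rootKey<ₗ⇔ : ∀ {K} → 0ₖ <ₗ K → ∀ ys → rootKey (node ys) <ₗ K ⇔ All (λ c → key c <ₗ K) ys
rootKey<ₗ⇔ {K} 0<K ys = mk⇔
  (λ root<K → All.map (λ c≤root → ≤ₗ-<ₗ-trans c≤root root<K) (key≤ₗrootKey ys))
  (All-key⇒rootKey {_<ₗ K} ys 0<K)

KeyBounds : Bd → ℕ → Bd → ℕ → Bd → ℕ → Key → Set
KeyBounds bk k bd d bl l (a , b , c) = Rel bk a k × Rel bd b d × Rel bl c l

Fam-resp : ∀ {n Δ bk k bd d bl l M M′} → M ≅ M′ →
  Fam n Δ bk k bd d bl l M → Fam n Δ bk k bd d bl l M′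
Fam-resp {bk = bk} {k} {bd} {d} {bl} {l} M≅M′@(node p) (vs≡ , es≡ , bounds) =
  trans (sym (vs-resp M≅M′)) vs≡ , trans (sym (es-resp M≅M′)) es≡ ,
  subst (KeyBounds bk k bd d bl l) (rootKey-resp p) bounds

vs≤vsL : ∀ ys → All (λ c → vsᶜ c ≤ vsL ys) ys
vs≤vsL [] = []
vs≤vsL ((x , t) ∷ ys) =
  m≤m+n (vs t) _ ∷ All.map (λ h → ≤-trans h (m≤n+m _ (vs t))) (vs≤vsL ys)

weight≤esL : ∀ ys → All (λ c → proj₁ c + esᶜ c ≤ esL ys) ys
weight≤esL [] = []
weight≤esL ((x , t) ∷ ys) =
  m≤m+n (x + es t) _ ∷ All.map (λ h → ≤-trans h (m≤n+m _ (x + es t))) (weight≤esL ys)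

maxV<vs : ∀ M → maxV M < vs M
maxV<vs (node ys) = s≤s (subst (_≤ vsL ys) (maxBy≡maxVL ys)
  (maxBy-lub U? vsᶜ ys (All.map (λ h _ → h) (vs≤vsL ys))))

maxM≤es : ∀ M → maxM M ≤ es M
maxM≤es (node ys) = subst (_≤ esL ys) (maxBy≡maxML V ys)
  (maxBy-lub (λ c → vsᶜ c ≟ V) esᶜ ys (All.map (λ h _ → ≤-trans (m≤n+m _ _) h) (weight≤esL ys)))
  where V = maxVL ys

maxL≤es : ∀ M → maxL M ≤ es M
maxL≤es (node ys) = subst (_≤ esL ys) (maxBy≡maxLL V M ys)
  (maxBy-lub (λ c → (vsᶜ c ≟ V) ×-dec (esᶜ c ≟ M)) proj₁ ys
    (All.map (λ h _ → ≤-trans (m≤m+n _ _) h) (weight≤esL ys)))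
  where
  V = maxVL ys
  M = maxML V ys

-- Counting isomorphism classes through the children of the root

HasForestCount : (Forest → Set) → ℕ → Set
HasForestCount P c = Σ (Fin c → Forest) λ r →
  (∀ i → P (r i)) × (∀ i j → r i ≋ r j → i ≡ j) × (∀ xs → P xs → ∃ λ i → xs ≋ r i)

children : RTree → Forest
children (node cs) = cs

HasCount⇒HasForestCount : ∀ {P c} → HasCount P c → HasForestCount (P ∘ node) c
HasCount⇒HasForestCount {P} (ts , valid , distinct , cover) =
  children ∘ lookup ts ,
  (λ i → subst P (sym (node-children (lookup ts i))) (valid i)) ,
  (λ i j p → distinct i j (subst₂ _≅_ (node-children (lookup ts i)) (node-children (lookup ts j))
                                      (node p))) ,
  λ xs pxs → let i , xs≅ = cover (node xs) pxs in
    i , node⁻¹ (subst (node xs ≅_) (sym (node-children (lookup ts i))) xs≅)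
  where
  node-children : ∀ t → node (children t) ≡ t
  node-children (node cs) = refl
  node⁻¹ : ∀ {xs ys} → node xs ≅ node ys → xs ≋ ys
  node⁻¹ (node p) = p

count-unique : ∀ {P a b} → HasForestCount P a → HasForestCount P b → a ≡ b
count-unique {P} (r , pr , ir , cr) (s , ps , is , cs) =
  ≤-antisym (injective⇒≤ (classify-injective ir cs pr)) (injective⇒≤ (classify-injective is cr ps))
  where
  classify-injective : ∀ {a b} {r : Fin a → Forest} {s : Fin b → Forest} →
    (∀ i j → r i ≋ r j → i ≡ j) → (cover : ∀ xs → P xs → ∃ λ j → xs ≋ s j) →
    (pr : ∀ i → P (r i)) → Injective _≡_ _≡_ (λ i → proj₁ (cover (r i) (pr i)))
  classify-injective {r = r} {s} distinct cover pr {i} {j} same =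
    distinct i j (≋-trans (proj₂ (cover (r i) (pr i)))
      (subst (λ j′ → s j′ ≋ r j) (sym same) (≋-sym (proj₂ (cover (r j) (pr j))))))

count-resp : ∀ {P Q c} → P ⊆ Q → Q ⊆ P → HasForestCount P c → HasForestCount Q c
count-resp P⊆Q Q⊆P (r , pr , ir , cr) = r , P⊆Q ∘ pr , ir , λ xs qxs → cr xs (Q⊆P qxs)

count-∅ : ∀ {P} → (∀ {xs} → ¬ P xs) → HasForestCount P 0
count-∅ ¬P = (λ ()) , (λ ()) , (λ ()) , λ _ pxs → contradiction pxs ¬P

count-⊎ : ∀ {P Q a b} → HasForestCount P a → HasForestCount Q b →
  (∀ {xs ys} → P xs → Q ys → ¬ xs ≋ ys) → HasForestCount (P ∪ Q) (a + b)
count-⊎ {P} {Q} {a} {b} (r , pr , ir , cr) (s , ps , is , cs) disjoint = t , pt , it , ct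
  where
  t : Fin (a + b) → Forest
  t k = [ r , s ]′ (splitAt a k)
  pt : ∀ k → (P ∪ Q) (t k)
  pt k with splitAt a k
  ... | inj₁ i = inj₁ (pr i)
  ... | inj₂ j = inj₂ (ps j)
  it : ∀ k k′ → t k ≋ t k′ → k ≡ k′
  it k k′ p with splitAt a k in split | splitAt a k′ in split′
  ... | inj₁ i | inj₁ i′ =
    trans (sym (splitAt⁻¹-↑ˡ split)) (trans (cong (_↑ˡ b) (ir i i′ p)) (splitAt⁻¹-↑ˡ split′))
  ... | inj₂ j | inj₂ j′ =
    trans (sym (splitAt⁻¹-↑ʳ split)) (trans (cong (a ↑ʳ_) (is j j′ p)) (splitAt⁻¹-↑ʳ split′))
  ... | inj₁ i | inj₂ j′ = contradiction p (disjoint (pr i) (ps j′))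
  ... | inj₂ j | inj₁ i′ = contradiction (≋-sym p) (disjoint (pr i′) (ps j))
  ct : ∀ xs → (P ∪ Q) xs → ∃ λ k → xs ≋ t k
  ct xs (inj₁ pxs) with cr xs pxs
  ... | i , p = i ↑ˡ b , subst (λ z → xs ≋ [ r , s ]′ z) (sym (splitAt-↑ˡ a i b)) p
  ct xs (inj₂ qxs) with cs xs qxs
  ... | j , p = a ↑ʳ j , subst (λ z → xs ≋ [ r , s ]′ z) (sym (splitAt-↑ʳ a b j)) p

module _ {S : Child → Set} (S? : Decidable S)
         (S-resp : ∀ {x t t′} → t ≅ t′ → S (x , t) → S (x , t′)) where

  private
    ¬S-resp : ∀ {x t t′} → t ≅ t′ → ¬ S (x , t) → ¬ S (x , t′)
    ¬S-resp e ¬s s′ = ¬s (S-resp (≅-sym e) s′)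

  ≋-split : ∀ zs → zs ≋ (filter S? zs ++ filter (¬? ∘ S?) zs)
  ≋-split [] = []
  ≋-split ((x , t) ∷ zs) with S? (x , t)
  ... | yes _ = cons {ys = []} (≅-refl t) (≋-split zs)
  ... | no _ = cons {ys = filter S? zs} (≅-refl t) (≋-split zs)

  filter-++-split : ∀ {xs ys} → All S xs → All (¬_ ∘ S) ys →
    filter S? (xs ++ ys) ≡ xs × filter (¬? ∘ S?) (xs ++ ys) ≡ ys
  filter-++-split {xs} {ys} sxs ¬sys =
    trans (filter-++ S? xs ys)
      (trans (cong₂ _++_ (filter-all S? sxs) (filter-none S? ¬sys)) (++-identityʳ xs)) ,
    trans (filter-++ (¬? ∘ S?) xs ys)
      (cong₂ _++_ (filter-none (¬? ∘ S?) (All.map (λ s ¬s → ¬s s) sxs)) (filter-all (¬? ∘ S?) ¬sys))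

  count-split : ∀ {P Q a b} → HasForestCount P a → HasForestCount Q b →
    P ⊆ All S → Q ⊆ All (¬_ ∘ S) →
    HasForestCount (λ zs → P (filter S? zs) × Q (filter (¬? ∘ S?) zs)) (a * b)
  count-split {P} {Q} {a} {b} (r , pr , ir , cr) (s , ps , is , cs) P⊆S Q⊆¬S = t , pt , it , ct
    where
    t : Fin (a * b) → Forest
    t k = r (proj₁ (remQuot {a} b k)) ++ s (proj₂ (remQuot {a} b k))
    split-t : ∀ i j → filter S? (r i ++ s j) ≡ r i × filter (¬? ∘ S?) (r i ++ s j) ≡ s j
    split-t i j = filter-++-split (P⊆S (pr i)) (Q⊆¬S (ps j))
    pt : ∀ k → P (filter S? (t k)) × Q (filter (¬? ∘ S?) (t k))
    pt k = let i , j = remQuot {a} b k ; eqS , eq¬S = split-t i j in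
      subst P (sym eqS) (pr i) , subst Q (sym eq¬S) (ps j)
    it : ∀ k k′ → t k ≋ t k′ → k ≡ k′
    it k k′ p = begin
      k              ≡⟨ combine-remQuot {a} b k ⟨
      combine i j    ≡⟨ cong₂ combine (ir i i′ rs≋) (is j j′ ss≋) ⟩
      combine i′ j′  ≡⟨ combine-remQuot {a} b k′ ⟩
      k′             ∎
      where
      open ≡-Reasoning
      i = proj₁ (remQuot {a} b k)
      j = proj₂ (remQuot {a} b k)
      i′ = proj₁ (remQuot {a} b k′)
      j′ = proj₂ (remQuot {a} b k′)
      rs≋ : r i ≋ r i′
      rs≋ = subst₂ _≋_ (proj₁ (split-t i j)) (proj₁ (split-t i′ j′)) (filter-resp-≋ S? S-resp p)
      ss≋ : s j ≋ s j′
      ss≋ = subst₂ _≋_ (proj₂ (split-t i j)) (proj₂ (split-t i′ j′))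
              (filter-resp-≋ (¬? ∘ S?) ¬S-resp p)
    ct : ∀ zs → P (filter S? zs) × Q (filter (¬? ∘ S?) zs) → ∃ λ k → zs ≋ t k
    ct zs (p , q) with cr _ p | cs _ q
    ... | i , pi | j , qj = combine i j ,
      subst (λ ij → zs ≋ (r (proj₁ ij) ++ s (proj₂ ij))) (sym (remQuot-combine i j))
        (≋-trans (≋-split zs) (≋-++ pi qj))

count-∷ : ∀ {Q n} x t → HasForestCount Q n →
  HasForestCount (λ xs → ∃ λ ys → Q ys × xs ≋ ((x , t) ∷ ys)) n
count-∷ x t (r , pr , ir , cr) =
  (λ i → (x , t) ∷ r i) , (λ i → r i , pr i , ≋-refl _) ,
  (λ i j p → ir i j (≋-∷-cancel (≅-refl t) p)) ,
  λ xs (ys , qys , p) → let i , ys≋ = cr ys qys in i , ≋-trans p (cons {ys = []} (≅-refl t) ys≋)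

count-sumP : ∀ {Q : ℕ → Forest → Set} {g : ℕ → ℕ} (cond : ℕ → Bool) →
  (∀ p → HasForestCount (Q p) (g p)) → (∀ {p q xs ys} → Q p xs → Q q ys → xs ≋ ys → p ≡ q) →
  ∀ N → HasForestCount (λ zs → ∃ λ p → 1 ≤ p × p ≤ N × T (cond p) × Q p zs) (sumP N cond g)
count-sumP cond count-Q index-unique zero =
  count-∅ λ (_ , 1≤p , p≤0 , _) → 1+n≰n (≤-trans 1≤p p≤0)
count-sumP {Q} {g} cond count-Q index-unique (suc N) =
  count-resp to from (count-⊎ (count-sumP cond count-Q index-unique N) last disjoint)
  where
  UpTo : ℕ → Forest → Set
  UpTo N′ zs = ∃ λ p → 1 ≤ p × p ≤ N′ × T (cond p) × Q p zs
  Last : Forest → Set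
  Last zs = T (cond (suc N)) × Q (suc N) zs
  last : HasForestCount Last (if cond (suc N) then g (suc N) else 0)
  last with cond (suc N)
  ... | true = count-resp (tt ,_) proj₂ (count-Q (suc N))
  ... | false = count-∅ proj₁
  to : ∀ {zs} → UpTo N zs ⊎ Last zs → UpTo (suc N) zs
  to (inj₁ (p , 1≤p , p≤N , c , q)) = p , 1≤p , m≤n⇒m≤1+n p≤N , c , q
  to (inj₂ (c , q)) = suc N , s≤s z≤n , ≤-refl , c , q
  from : ∀ {zs} → UpTo (suc N) zs → UpTo N zs ⊎ Last zs
  from (p , 1≤p , p≤1+N , c , q) with m≤n⇒m<n∨m≡n p≤1+N
  ... | inj₁ (s≤s p≤N) = inj₁ (p , 1≤p , p≤N , c , q)
  ... | inj₂ refl = inj₂ (c , q)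
  disjoint : ∀ {xs ys} → UpTo N xs → Last ys → ¬ xs ≋ ys
  disjoint (p , _ , p≤N , _ , q) (_ , q′) xs≋ys =
    1+n≰n (subst (_≤ N) (index-unique q q′ xs≋ys) p≤N)

-- Multisets of children

multichoose : ℕ → ℕ → ℕ
multichoose zero zero = 1
multichoose zero (suc p) = 0
multichoose (suc c) zero = 1
multichoose (suc c) (suc p) = multichoose c (suc p) + multichoose (suc c) p

multichoose≡C : ∀ c p → multichoose c p ≡ (c + p ∸ 1) C p
multichoose≡C zero zero = refl
multichoose≡C zero (suc p) = sym (k>n⇒nCk≡0 (n<1+n p))
multichoose≡C (suc c) zero = refl
multichoose≡C (suc c) (suc p) = begin
  multichoose c (suc p) + multichoose (suc c) p
    ≡⟨ cong₂ _+_ (multichoose≡C c (suc p)) (multichoose≡C (suc c) p) ⟩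
  (c + suc p ∸ 1) C suc p + (c + p) C p
    ≡⟨ cong (λ m → (m ∸ 1) C suc p + (c + p) C p) (+-suc c p) ⟩
  (c + p) C suc p + (c + p) C p
    ≡⟨ +-comm ((c + p) C suc p) _ ⟩
  (c + p) C p + (c + p) C suc p
    ≡⟨ nCk+nC[k+1]≡[n+1]C[k+1] (c + p) p ⟩
  suc (c + p) C suc p
    ≡⟨ cong (_C suc p) (+-suc c p) ⟨
  (c + suc p) C suc p
    ∎
  where open ≡-Reasoning

module Multisets (ℓ : ℕ) where

  OfKind : ∀ {c} → (Fin c → RTree) → Child → Set
  OfKind r c = proj₁ c ≡ ℓ × ∃ λ i → proj₂ c ≅ r i

  Multiset : ∀ {c} → (Fin c → RTree) → ℕ → Forest → Set
  Multiset r p xs = All (OfKind r) xs × length xs ≡ p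

  Multiset-resp : ∀ {c} (r : Fin c → RTree) p {xs ys} →
    xs ≋ ys → Multiset r p xs → Multiset r p ys
  Multiset-resp r p xs≋ys (kinds , len) =
    All-resp-≋ (λ t≅t′ (x≡ , i , t≅) → x≡ , i , ≅-trans (≅-sym t≅t′) t≅) xs≋ys kinds ,
    trans (sym (length-resp-≋ xs≋ys)) len

  count-empty-multiset : ∀ {c} (r : Fin c → RTree) → HasForestCount (Multiset r 0) 1
  count-empty-multiset r = (λ _ → []) , (λ _ → [] , refl) , (λ { zero zero _ → refl }) ,
    λ { [] _ → zero , [] ; (_ ∷ _) (_ , ()) }

  take-first-kind : ∀ {c} (r : Fin (suc c) → RTree) {xs} → All (OfKind r) xs →
    All (OfKind (r ∘ suc)) xs ⊎
    ∃₂ λ u₁ u₂ → ∃ λ t → xs ≡ u₁ ++ (ℓ , t) ∷ u₂ × t ≅ r zero × All (OfKind r) (u₁ ++ u₂)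
  take-first-kind r [] = inj₁ []
  take-first-kind r ((refl , zero , t≅) ∷ kinds) = inj₂ ([] , _ , _ , refl , t≅ , kinds)
  take-first-kind r {c ∷ _} ((refl , suc i , t≅) ∷ kinds) with take-first-kind r kinds
  ... | inj₁ others = inj₁ ((refl , i , t≅) ∷ others)
  ... | inj₂ (u₁ , u₂ , t , refl , t≅r₀ , rest) =
    inj₂ (c ∷ u₁ , u₂ , t , refl , t≅r₀ , (refl , suc i , t≅) ∷ rest)

  count-multisets-of : ∀ c (r : Fin c → RTree) → (∀ i j → r i ≅ r j → i ≡ j) →
    ∀ p → HasForestCount (Multiset r p) (multichoose c p)
  count-multisets-of zero r _ zero = count-empty-multiset r
  count-multisets-of zero r _ (suc p) = count-∅ λ { (((_ , () , _) ∷ _) , _) }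
  count-multisets-of (suc c) r _ zero = count-empty-multiset r
  count-multisets-of (suc c) r distinct (suc p) =
    count-resp to from
      (count-⊎ (count-multisets-of c (r ∘ suc) distinct′ (suc p))
               (count-∷ ℓ (r zero) (count-multisets-of (suc c) r distinct p)) disjoint)
    where
    distinct′ : ∀ i j → r (suc i) ≅ r (suc j) → i ≡ j
    distinct′ i j r≅r = Fin.suc-injective (distinct (suc i) (suc j) r≅r)
    WithoutFirst WithFirst : Forest → Set
    WithoutFirst = Multiset (r ∘ suc) (suc p)
    WithFirst xs = ∃ λ ys → Multiset r p ys × xs ≋ ((ℓ , r zero) ∷ ys)
    to : WithoutFirst ∪ WithFirst ⊆ Multiset r (suc p)
    to (inj₁ (kinds , len)) = All.map (λ (x≡ , i , t≅) → x≡ , suc i , t≅) kinds , len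
    to (inj₂ (ys , (kinds , len) , xs≋)) =
      Multiset-resp r (suc p) (≋-sym xs≋) ((refl , zero , ≅-refl (r zero)) ∷ kinds , cong suc len)
    from : Multiset r (suc p) ⊆ WithoutFirst ∪ WithFirst
    from (kinds , len) with take-first-kind r kinds
    ... | inj₁ others = inj₁ (others , len)
    ... | inj₂ (u₁ , u₂ , t , refl , t≅r₀ , rest) =
      inj₂ (u₁ ++ u₂ , (rest , suc-injective (trans (sym (length-insert u₁ u₂ (ℓ , t))) len)) ,
            ≋-insert u₁ u₂ ℓ (u₁ ++ u₂) t≅r₀ (≋-refl _))
    disjoint : ∀ {xs ys} → WithoutFirst xs → WithFirst ys → ¬ xs ≋ ys
    disjoint {xs} (kinds , _) (zs , _ , ys≋) xs≋ys
      with ≋-remove [] zs ℓ (r zero) xs (≋-sym (≋-trans xs≋ys ys≋))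
    ... | z₁ , z₂ , t , refl , r₀≅t , _ with ++⁻ z₁ kinds
    ...   | _ , ((_ , i , t≅) ∷ _) with distinct zero (suc i) (≅-trans r₀≅t t≅)
    ...     | ()

count-multisets : ∀ {P : RTree → Set} {c} ℓ → (∀ {t t′} → t ≅ t′ → P t → P t′) → HasCount P c →
  ∀ p → HasForestCount (λ xs → All (λ c → proj₁ c ≡ ℓ × P (proj₂ c)) xs × length xs ≡ p)
                       (multichoose c p)
count-multisets {P} {c} ℓ P-resp (ts , valid , distinct , cover) p =
  count-resp (Product.map₁ (All.map of-kind⇒P)) (Product.map₁ (All.map P⇒of-kind))
    (count-multisets-of c (lookup ts) distinct p)
  where
  open Multisets ℓ
  of-kind⇒P : ∀ {c} → OfKind (lookup ts) c → proj₁ c ≡ ℓ × P (proj₂ c)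
  of-kind⇒P (x≡ , i , t≅) = x≡ , P-resp (≅-sym t≅) (valid i)
  P⇒of-kind : ∀ {c} → proj₁ c ≡ ℓ × P (proj₂ c) → OfKind (lookup ts) c
  P⇒of-kind {_ , t} (x≡ , pt) = x≡ , cover t pt

-- Splitting off the top children

<⇒≤∸1 : ∀ {a b} → a < b → a ≤ b ∸ 1
<⇒≤∸1 (s≤s a≤b) = a≤b

≤∸1⇒< : ∀ {a b} → 1 ≤ b → a ≤ b ∸ 1 → a < b
≤∸1⇒< {b = suc _} _ a≤b = s≤s a≤b

m+n≡o⇒n≡o∸m : ∀ {m n o} → m + n ≡ o → n ≡ o ∸ m
m+n≡o⇒n≡o∸m {m} {n} refl = sym (m+n∸m≡n m n)

module Decomposition (n k d l Δ : ℕ) (1≤k : 1 ≤ k) where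

  K : Key
  K = k , d , l

  0<K : 0ₖ <ₗ K
  0<K = inj₁ 1≤k

  K≢0 : K ≢ 0ₖ
  K≢0 K≡0 = n≮0 (subst (1 ≤_) (cong proj₁ K≡0) 1≤k)

  Top : Child → Set
  Top c = key c ≡ K

  Top? : Decidable Top
  Top? c = ≡-dec _≟_ (≡-dec _≟_ _≟_) (key c) K

  Top-resp : ∀ {x t t′} → t ≅ t′ → Top (x , t) → Top (x , t′)
  Top-resp t≅t′ top = trans (sym (key-resp t≅t′)) top

  tops rest : Forest → Forest
  tops = filter Top?
  rest = filter (¬? ∘ Top?)

  nₚ Δₚ : ℕ → ℕ
  nₚ p = n ∸ p * k
  Δₚ = Δp d l Δ

  Below : ℕ → Forest → Set
  Below p ys = (vs (node ys) ≡ nₚ p × es (node ys) ≡ Δₚ p) × rootKey (node ys) <ₗ K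

  Summand : ℕ → Forest → Set
  Summand p zs = (All Top (tops zs) × length (tops zs) ≡ p) × Below p (rest zs)

  InSummand : Forest → Set
  InSummand zs = ∃ λ p → 1 ≤ p × p ≤ n × T (admissible n k d l Δ p) × Summand p zs

  -- The guards 1 ≤ ℓ and 1 ≤ d matter: for ℓ = 0 (d = 0) the bound ℓ ∸ 1 (d ∸ 1) is a
  -- truncated 0 and the unguarded family need not be empty.
  FamA FamB FamC : ℕ → Forest → Set
  FamA p ys = 1 ≤ l × Fam (nₚ p) (Δₚ p) eq k eq d le (Δₚ p ⊓ (l ∸ 1)) (node ys)
  FamB p ys = 1 ≤ d × Fam (nₚ p) (Δₚ p) eq k le (Δₚ p ⊓ (d ∸ 1)) le (Δₚ p) (node ys)
  FamC p ys = Fam (nₚ p) (Δₚ p) le ((nₚ p ∸ 1) ⊓ (k ∸ 1)) le (Δₚ p) le (Δₚ p) (node ys)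

  Below⇔FamABC : ∀ p ys → Below p ys ⇔ ((FamA p ys ⊎ FamB p ys) ⊎ FamC p ys)
  Below⇔FamABC p ys = mk⇔ to from
    where
    M = node ys
    maxM≤Δₚ : es M ≡ Δₚ p → maxM M ≤ Δₚ p
    maxM≤Δₚ es≡ = subst (maxM M ≤_) es≡ (maxM≤es M)
    maxL≤Δₚ : es M ≡ Δₚ p → maxL M ≤ Δₚ p
    maxL≤Δₚ es≡ = subst (maxL M ≤_) es≡ (maxL≤es M)
    to : Below p ys → (FamA p ys ⊎ FamB p ys) ⊎ FamC p ys
    to ((vs≡ , es≡) , inj₁ V<k) =
      inj₂ (vs≡ , es≡ , ⊓-glb (<⇒≤∸1 (subst (maxV M <_) vs≡ (maxV<vs M))) (<⇒≤∸1 V<k) ,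
            maxM≤Δₚ es≡ , maxL≤Δₚ es≡)
    to ((vs≡ , es≡) , inj₂ (V≡k , inj₁ M<d)) =
      inj₁ (inj₂ (≤-trans (s≤s z≤n) M<d , vs≡ , es≡ , V≡k ,
                  ⊓-glb (maxM≤Δₚ es≡) (<⇒≤∸1 M<d) , maxL≤Δₚ es≡))
    to ((vs≡ , es≡) , inj₂ (V≡k , inj₂ (M≡d , L<l))) =
      inj₁ (inj₁ (≤-trans (s≤s z≤n) L<l , vs≡ , es≡ , V≡k , M≡d ,
                  ⊓-glb (maxL≤Δₚ es≡) (<⇒≤∸1 L<l)))
    from : (FamA p ys ⊎ FamB p ys) ⊎ FamC p ys → Below p ys
    from (inj₁ (inj₁ (1≤l , vs≡ , es≡ , V≡k , M≡d , L≤))) =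
      (vs≡ , es≡) , inj₂ (V≡k , inj₂ (M≡d , ≤∸1⇒< 1≤l (m≤n⊓o⇒m≤o (Δₚ p) _ L≤)))
    from (inj₁ (inj₂ (1≤d , vs≡ , es≡ , V≡k , M≤ , _))) =
      (vs≡ , es≡) , inj₂ (V≡k , inj₁ (≤∸1⇒< 1≤d (m≤n⊓o⇒m≤o (Δₚ p) _ M≤)))
    from (inj₂ (vs≡ , es≡ , V≤ , _)) =
      (vs≡ , es≡) , inj₁ (≤∸1⇒< 1≤k (m≤n⊓o⇒m≤o (nₚ p ∸ 1) _ V≤))

  vsL-tops : ∀ {xs} → All Top xs → vsL xs ≡ length xs * k
  vsL-tops [] = refl
  vsL-tops (top ∷ tops) = cong₂ _+_ (cong proj₁ top) (vsL-tops tops)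

  esL-tops : ∀ {xs} → All Top xs → esL xs ≡ length xs * (d + l)
  esL-tops [] = refl
  esL-tops {(x , t) ∷ _} (top ∷ tops) = cong₂ _+_ weight≡ (esL-tops tops)
    where
    weight≡ : x + es t ≡ d + l
    weight≡ = trans (+-comm x (es t)) (cong₂ _+_ (cong (proj₁ ∘ proj₂) top) (cong (proj₂ ∘ proj₂) top))

  vsL-split : ∀ zs → vsL zs ≡ length (tops zs) * k + vsL (rest zs)
  vsL-split zs = begin
    vsL zs                               ≡⟨ vsL-resp (≋-split Top? Top-resp zs) ⟩
    vsL (tops zs ++ rest zs)             ≡⟨ vsL-++ (tops zs) (rest zs) ⟩
    vsL (tops zs) + vsL (rest zs)        ≡⟨ cong (_+ vsL (rest zs)) (vsL-tops all-top) ⟩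
    length (tops zs) * k + vsL (rest zs) ∎
    where
    open ≡-Reasoning
    all-top = all-filter Top? zs

  esL-split : ∀ zs → esL zs ≡ length (tops zs) * (d + l) + esL (rest zs)
  esL-split zs = begin
    esL zs                                     ≡⟨ esL-resp (≋-split Top? Top-resp zs) ⟩
    esL (tops zs ++ rest zs)                   ≡⟨ esL-++ (tops zs) (rest zs) ⟩
    esL (tops zs) + esL (rest zs)              ≡⟨ cong (_+ esL (rest zs)) (esL-tops all-top) ⟩
    length (tops zs) * (d + l) + esL (rest zs) ∎
    where
    open ≡-Reasoning
    all-top = all-filter Top? zs

  All≤K⇔All<K-rest : ∀ zs → All (λ c → key c ≤ₗ K) zs ⇔ All (λ c → key c <ₗ K) (rest zs)
  All≤K⇔All<K-rest zs = mk⇔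
    (λ all≤ → All.zipWith strict (filter⁺ (¬? ∘ Top?) all≤ , all-filter (¬? ∘ Top?) zs))
    (λ rest< → filter⁻ Top? (All.map inj₂ (all-filter Top? zs)) (All.map inj₁ rest<))
    where
    strict : ∀ {c} → key c ≤ₗ K × ¬ Top c → key c <ₗ K
    strict (inj₁ c<K , _) = c<K
    strict (inj₂ top , ¬top) = contradiction top ¬top

  Any-top : ∀ zs → 1 ≤ length (tops zs) → Any Top zs
  Any-top zs 1≤len = Any-filter⁻ Top? (nonempty (all-filter Top? zs) 1≤len)
    where
    nonempty : ∀ {xs} → All Top xs → 1 ≤ length xs → Any Top xs
    nonempty (top ∷ _) _ = here top

  Fam⇒InSummand : ∀ zs → Fam n Δ eq k eq d eq l (node zs) → InSummand zs
  Fam⇒InSummand zs (vs≡ , es≡ , V≡ , M≡ , L≡)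
    with Equivalence.to (rootKey≡⇔ K≢0 zs) (cong₂ _,_ V≡ (cong₂ _,_ M≡ L≡))
  ... | below , attained =
    p , filter-some Top? attained , p≤n , Equivalence.from T-∧ (≤⇒≤ᵇ pk≤ , ≤⇒≤ᵇ p[d+l]≤) ,
    (all-filter Top? zs , refl) , (m+n≡o⇒n≡o∸m vs-rest , m+n≡o⇒n≡o∸m es-rest) ,
    Equivalence.from (rootKey<ₗ⇔ 0<K (rest zs)) (Equivalence.to (All≤K⇔All<K-rest zs) below)
    where
    p = length (tops zs)
    vs-rest : p * k + suc (vsL (rest zs)) ≡ n
    vs-rest = trans (+-suc (p * k) _) (trans (cong suc (sym (vsL-split zs))) vs≡)
    es-rest : p * (d + l) + esL (rest zs) ≡ Δ
    es-rest = trans (sym (esL-split zs)) es≡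
    pk≤ : p * k ≤ n ∸ 1
    pk≤ = subst (p * k ≤_) (trans (sym (vsL-split zs)) (cong (_∸ 1) vs≡)) (m≤m+n _ _)
    p[d+l]≤ : p * (d + l) ≤ Δ
    p[d+l]≤ = subst (p * (d + l) ≤_) es-rest (m≤m+n _ _)
    p≤n : p ≤ n
    p≤n = ≤-trans (subst (_≤ p * k) (*-identityʳ p) (*-monoʳ-≤ p 1≤k)) (≤-trans pk≤ (m∸n≤m n 1))

  InSummand⇒Fam : ∀ zs → InSummand zs → Fam n Δ eq k eq d eq l (node zs)
  InSummand⇒Fam zs (p , 1≤p , _ , admissible-p , (_ , len) , (rest-vs , rest-es) , rest<K) =
    vs≡ , es≡ , proj₁ (,-injective root≡K) , ,-injective (proj₂ (,-injective root≡K))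
    where
    open ≡-Reasoning
    pk≤ : p * k ≤ n ∸ 1
    pk≤ = ≤ᵇ⇒≤ _ _ (proj₁ (Equivalence.to T-∧ admissible-p))
    p[d+l]≤ : p * (d + l) ≤ Δ
    p[d+l]≤ = ≤ᵇ⇒≤ _ _ (proj₂ (Equivalence.to T-∧ admissible-p))
    vs≡ : suc (vsL zs) ≡ n
    vs≡ = begin
      suc (vsL zs)                                ≡⟨ cong suc (vsL-split zs) ⟩
      suc (length (tops zs) * k + vsL (rest zs))  ≡⟨ +-suc _ _ ⟨
      length (tops zs) * k + suc (vsL (rest zs))  ≡⟨ cong₂ (λ q v → q * k + v) len rest-vs ⟩
      p * k + (n ∸ p * k)                         ≡⟨ m+[n∸m]≡n (≤-trans pk≤ (m∸n≤m n 1)) ⟩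
      n                                           ∎
    es≡ : esL zs ≡ Δ
    es≡ = begin
      esL zs                                      ≡⟨ esL-split zs ⟩
      length (tops zs) * (d + l) + esL (rest zs)  ≡⟨ cong₂ (λ q e → q * (d + l) + e) len rest-es ⟩
      p * (d + l) + (Δ ∸ p * (d + l))             ≡⟨ m+[n∸m]≡n p[d+l]≤ ⟩
      Δ                                           ∎
    root≡K : rootKey (node zs) ≡ K
    root≡K = Equivalence.from (rootKey≡⇔ K≢0 zs)
      (Equivalence.from (All≤K⇔All<K-rest zs) (Equivalence.to (rootKey<ₗ⇔ 0<K (rest zs)) rest<K) ,
       Any-top zs (subst (1 ≤_) (sym len) 1≤p))

module Counting (m : Counter) (isC : IsCounter m) (n k d l Δ : ℕ) (1≤k : 1 ≤ k) where

  open Decomposition n k d l Δ 1≤k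

  count-tops : ∀ p → HasForestCount (λ xs → All Top xs × length xs ≡ p) (fK m k d p)
  count-tops p =
    subst (HasForestCount (λ xs → All Top xs × length xs ≡ p))
          (multichoose≡C (m k d le (k ∸ 1) le d le d) p)
      (count-resp (Product.map₁ (All.map kind⇒top)) (Product.map₁ (All.map top⇒kind))
        (count-multisets l Fam-resp (isC k d le (k ∸ 1) le d le d) p))
    where
    kind⇒top : ∀ {c} → proj₁ c ≡ l × Fam k d le (k ∸ 1) le d le d (proj₂ c) → Top c
    kind⇒top (x≡ , vs≡ , es≡ , _) = cong₂ _,_ vs≡ (cong₂ _,_ es≡ x≡)
    top⇒kind : ∀ {c} → Top c → proj₁ c ≡ l × Fam k d le (k ∸ 1) le d le d (proj₂ c)
    top⇒kind {_ , M} refl = refl , refl , refl , <⇒≤∸1 (maxV<vs M) , maxM≤es M , maxL≤es M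

  Below⇒All¬Top : ∀ {p ys} → Below p ys → All (¬_ ∘ Top) ys
  Below⇒All¬Top {ys = ys} (_ , root<K) =
    All.map below⇒¬top (Equivalence.to (rootKey<ₗ⇔ 0<K ys) root<K)
    where
    below⇒¬top : ∀ {c} → key c <ₗ K → ¬ Top c
    below⇒¬top c<K refl = <ₗ-asym c<K c<K

  count-Below : ∀ {a b} p → HasForestCount (FamA p) a → HasForestCount (FamB p) b →
    HasForestCount (Below p) (a + b + Cp m n k d l Δ p)
  count-Below p count-A count-B =
    count-resp (λ {ys} → Equivalence.from (Below⇔FamABC p ys))
               (λ {ys} → Equivalence.to (Below⇔FamABC p ys))
      (count-⊎ (count-⊎ count-A count-B A∩B) count-C AB∩C)
    where
    count-C : HasForestCount (FamC p) (Cp m n k d l Δ p)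
    count-C =
      HasCount⇒HasForestCount (isC (nₚ p) (Δₚ p) le ((nₚ p ∸ 1) ⊓ (k ∸ 1)) le (Δₚ p) le (Δₚ p))
    A∩B : ∀ {xs ys} → FamA p xs → FamB p ys → ¬ xs ≋ ys
    A∩B (_ , _ , _ , _ , M≡d , _) (1≤d , famB) xs≋ys with Fam-resp (node (≋-sym xs≋ys)) famB
    ... | _ , _ , _ , M≤ , _ = <-irrefl M≡d (≤∸1⇒< 1≤d (m≤n⊓o⇒m≤o (Δₚ p) (d ∸ 1) M≤))
    maxV≡k : ∀ {xs} → FamA p xs ⊎ FamB p xs → maxV (node xs) ≡ k
    maxV≡k (inj₁ (_ , _ , _ , V≡k , _)) = V≡k
    maxV≡k (inj₂ (_ , _ , _ , V≡k , _)) = V≡k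
    AB∩C : ∀ {xs ys} → FamA p xs ⊎ FamB p xs → FamC p ys → ¬ xs ≋ ys
    AB∩C {xs} famAB famC xs≋ys with Fam-resp (node (≋-sym xs≋ys)) famC
    ... | _ , _ , V≤ , _ =
      <-irrefl (maxV≡k {xs} famAB) (≤∸1⇒< 1≤k (m≤n⊓o⇒m≤o (nₚ p ∸ 1) (k ∸ 1) V≤))

  count-family : ∀ {h : ℕ → ℕ} → (∀ p → HasForestCount (Below p) (h p)) →
    m n Δ eq k eq d eq l ≡ sumP n (admissible n k d l Δ) (λ p → fK m k d p * h p)
  count-family {h} count-below =
    count-unique (HasCount⇒HasForestCount (isC n Δ eq k eq d eq l))
      (count-resp (λ {zs} → InSummand⇒Fam zs) (λ {zs} → Fam⇒InSummand zs)
        (count-sumP {Summand} (admissible n k d l Δ) count-Summand index-unique n))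
    where
    count-Summand : ∀ p → HasForestCount (Summand p) (fK m k d p * h p)
    count-Summand p =
      count-split Top? Top-resp (count-tops p) (count-below p) proj₁ (Below⇒All¬Top {p})
    index-unique : ∀ {p q xs ys} → Summand p xs → Summand q ys → xs ≋ ys → p ≡ q
    index-unique ((_ , lenxs) , _) ((_ , lenys) , _) xs≋ys =
      trans (sym lenxs) (trans (length-resp-≋ (filter-resp-≋ Top? Top-resp xs≋ys)) lenys)

lemma2 : (m : Counter) → IsCounter m →
    (n k d l Δ : ℕ) → 3 ≤ n → 1 ≤ k → d + l ≤ Δ → l ≤ Δ →
      (d ≡ 0 → l ≡ 0 → m n Δ eq k eq d eq l ≡
        sumP n (admissible n k d l Δ) (λ p → fK m k d p * Cp m n k d l Δ p))
    × (1 ≤ d → l ≡ 0 → m n Δ eq k eq d eq l ≡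
        sumP n (admissible n k d l Δ) (λ p → fK m k d p * (Bp m n k d l Δ p + Cp m n k d l Δ p)))
    × (d ≡ 0 → 1 ≤ l → m n Δ eq k eq d eq l ≡
        sumP n (admissible n k d l Δ) (λ p → fK m k d p * (Ap m n k d l Δ p + Cp m n k d l Δ p)))
    × (1 ≤ d → 1 ≤ l → m n Δ eq k eq d eq l ≡
        sumP n (admissible n k d l Δ)
          (λ p → fK m k d p * (Ap m n k d l Δ p + Bp m n k d l Δ p + Cp m n k d l Δ p)))
lemma2 m isC n k d l Δ _ 1≤k _ _ =
  (λ d≡0 l≡0 → count-family {C} λ p → count-Below p (no-A l≡0 p) (no-B d≡0 p)) ,
  (λ 1≤d l≡0 → count-family {λ p → B p + C p} λ p → count-Below p (no-A l≡0 p) (count-B 1≤d p)) ,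
  (λ d≡0 1≤l → count-family {λ p → A p + C p} λ p →
     subst (HasForestCount _) (cong (_+ C p) (+-identityʳ (A p)))
       (count-Below p (count-A 1≤l p) (no-B d≡0 p))) ,
  (λ 1≤d 1≤l → count-family {λ p → A p + B p + C p} λ p →
     count-Below p (count-A 1≤l p) (count-B 1≤d p))
  where
  open Decomposition n k d l Δ 1≤k
  open Counting m isC n k d l Δ 1≤k
  A B C : ℕ → ℕ
  A = Ap m n k d l Δ
  B = Bp m n k d l Δ
  C = Cp m n k d l Δ
  count-A : 1 ≤ l → ∀ p → HasForestCount (FamA p) (A p)
  count-A 1≤l p = count-resp (1≤l ,_) proj₂ (HasCount⇒HasForestCount (isC _ _ eq k eq d le _))
  count-B : 1 ≤ d → ∀ p → HasForestCount (FamB p) (B p)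
  count-B 1≤d p = count-resp (1≤d ,_) proj₂ (HasCount⇒HasForestCount (isC _ _ eq k le _ le _))
  no-A : l ≡ 0 → ∀ p → HasForestCount (FamA p) 0
  no-A refl p = count-∅ λ ()
  no-B : d ≡ 0 → ∀ p → HasForestCount (FamB p) 0
  no-B refl p = count-∅ λ ()
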